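{- There exists $\tau_0>0$ such that the following holds for all constants $0 < \alpha < \nu \leq \tau \le \tau_0$. Suppose $G$ is a graph on $n$ vertices which is a robust $(\nu,\tau)$-expander and $S \subseteq V(G)$ has size $\alpha n$. Then $G - S$ is a robust $(\nu-\alpha, \tau+\alpha)$-expander.
   Context: For a graph $G$ on $n$ vertices and $S \subseteq V(G)$, $RN_{\nu,G}(S)$ is the set of vertices $v \in V(G)$ with $|N(v)\cap S| \geq \nu n$; $G$ is a robust $(\nu,\tau)$-expander if every $S \subseteq V(G)$ with $\tau n \leq |S| \leq (1-\tau)n$ satisfies $|RN_{\nu,G}(S)| \geq |S| + \nu n$ (here $n=|G|$ for the graph in question). (The paper writes the hypothesis as $0<\alpha<\nu\le\tau\ll 1$.)
   Formalization: The constants ν and τ range over the rationals, and the threshold τ₀ is taken in the rationals. -}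

module Defs where

open import Data.Nat using (ℕ)
open import Data.Bool using (Bool; true; false; _∧_)
open import Data.Fin using (Fin)
open import Data.Fin.Subset using (Subset; ∣_∣; _∩_; _⊆_; ∁; ⊤)
open import Data.Vec using (tabulate; lookup)
open import Data.Integer using (+_)
open import Data.Rational using (ℚ; _/_; _≤_; _+_; _-_; _*_; 1ℚ)
open import Data.Rational.Properties using (_≤?_)
open import Relation.Nullary.Decidable using (⌊_⌋)
open import Relation.Binary.PropositionalEquality using (_≡_)

ℕ→ℚ : ℕ → ℚ
ℕ→ℚ k = (+ k) / 1

size : ∀ {n} → Subset n → ℚ
size X = ℕ→ℚ (∣_∣ X)

record Graph (n : ℕ) : Set where
  field
    adj     : Fin n → Fin n → Bool
    sym     : ∀ u v → adj u v ≡ adj v u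
    irrefl  : ∀ v → adj v v ≡ false

open Graph public

N : ∀ {n} → Graph n → Fin n → Subset n
N G v = tabulate (adj G v)

-- We work with induced subgraphs G[W] (W ⊆ V(G)) directly: G[W] has vertex
-- set W, |G[W]| = ∣ W ∣, and the neighbourhood of v ∈ W in G[W] is N(v) ∩ W.
RN : ∀ {n} → Graph n → Subset n → ℚ → Subset n → Subset n
RN G W ν S =
  tabulate (λ v → lookup W v ∧ ⌊ ν * size W ≤? size ((N G v ∩ W) ∩ S) ⌋)

RobustExpanderOn : ∀ {n} → Graph n → Subset n → ℚ → ℚ → Set
RobustExpanderOn G W ν τ =
  ∀ (S : Subset _) → S ⊆ W →
    τ * size W ≤ size S →
    size S ≤ (1ℚ - τ) * size W →
    size S + ν * size W ≤ size (RN G W ν S)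


RobustExpander : ∀ {n} → Graph n → ℚ → ℚ → Set
RobustExpander G ν τ = RobustExpanderOn G ⊤ ν τ

RobustExpanderMinus : ∀ {n} → Graph n → Subset n → ℚ → ℚ → Set
RobustExpanderMinus G S ν τ = RobustExpanderOn G (∁ S) ν τ

module Submission where

-- Let G[U] be a robust (ν,τ)-expander, S a set with |S| = α|U| and
-- W = U ∖ S, so |U| - α|U| ≤ |W| ≤ |U|.  Take X ⊆ W with
-- (τ+α)|W| ≤ |X| ≤ (1-τ-α)|W|.  Then τ|U| ≤ |X| ≤ (1-τ)|U|, so
-- |RN_U(X)| ≥ |X| + ν|U|.  A vertex v ∈ W of RN_U(X) has at least
-- ν|U| ≥ (ν-α)|W| neighbours in X ⊆ W, hence lies in RN_W(X); and at
-- most |S| = α|U| vertices of RN_U(X) are lost outside W.  Therefore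
-- |RN_W(X)| ≥ |X| + ν|U| - α|U| ≥ |X| + (ν-α)|W|.

open import Defs
open import Data.Nat using (ℕ)
open import Data.Product using (Σ; _×_)
open import Data.Fin.Subset using (Subset)
open import Data.Rational using (ℚ; _<_; _≤_; _+_; _-_; _*_; 0ℚ)
open import Relation.Binary.PropositionalEquality using (_≡_)

import Data.Nat as ℕ
import Data.Nat.Properties as ℕ
import Data.Integer as ℤ
import Data.Integer.Properties as ℤ
import Data.Nat.Coprimality as Coprime
open import Data.Rational using (mkℚ; 1ℚ; ½; -_; _/_; *≤*; nonNegative)
open import Data.Rational.Properties
  using (≤-trans; <⇒≤; +-mono-≤; +-monoˡ-≤; +-monoʳ-≤; *-monoˡ-≤-nonNeg;
         positive⁻¹; normalize-coprime)
  renaming (module ≤-Reasoning to ℚ-≤-Reasoning)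
open import Data.Rational.Solver using (module +-*-Solver)
open import Data.Product using (_,_; proj₁; proj₂)
open import Data.Bool using (Bool; true; false; _∧_)
open import Data.Bool.Properties using (T-≡)
open import Data.Vec using ([]; _∷_; lookup; tabulate)
open import Data.Vec.Properties using (lookup∘tabulate; []=⇒lookup; lookup⇒[]=)
open import Data.Fin using (Fin)
open import Data.Fin.Subset using (∣_∣; _∩_; _⊆_; _∈_; ∁; ⊤)
open import Data.Fin.Subset.Properties
  using (p⊆q⇒∣p∣≤∣q∣; p∩q⊆p; x∈p∩q⁺; x∈p∩q⁻; ∣⊤∣≡n; ∩-identityˡ)
open import Relation.Nullary.Decidable using (toWitness; fromWitness)
open import Relation.Binary.PropositionalEquality
  using (refl; trans; cong; cong₂; subst; subst₂)
  renaming (sym to ≡-sym)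
open import Function using (Equivalence)

open +-*-Solver

ℕ→ℚ-as-mkℚ : ∀ k → ℕ→ℚ k ≡ mkℚ (ℤ.+ k) 0 (Coprime.sym (Coprime.1-coprimeTo k))
ℕ→ℚ-as-mkℚ k = normalize-coprime (Coprime.sym (Coprime.1-coprimeTo k))

ℕ→ℚ-+ : ∀ a b → ℕ→ℚ (a ℕ.+ b) ≡ ℕ→ℚ a + ℕ→ℚ b
ℕ→ℚ-+ a b rewrite ℕ→ℚ-as-mkℚ a | ℕ→ℚ-as-mkℚ b | ℕ.*-identityʳ a | ℕ.*-identityʳ b =
  cong (λ z → z / 1) (cong₂ ℤ._+_ (≡-sym (ℤ.+◃n≡+n a)) (≡-sym (ℤ.+◃n≡+n b)))

ℕ→ℚ-mono : ∀ {a b} → a ℕ.≤ b → ℕ→ℚ a ≤ ℕ→ℚ b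
ℕ→ℚ-mono {a} {b} a≤b rewrite ℕ→ℚ-as-mkℚ a | ℕ→ℚ-as-mkℚ b =
  *≤* (subst₂ ℤ._≤_ (≡-sym (ℤ.*-identityʳ (ℤ.+ a))) (≡-sym (ℤ.*-identityʳ (ℤ.+ b))) (ℤ.+≤+ a≤b))

size-nonneg : ∀ {n} (p : Subset n) → 0ℚ ≤ size p
size-nonneg p = ℕ→ℚ-mono {0} {∣ p ∣} ℕ.z≤n

size-⊤ : ∀ n → size (⊤ {n}) ≡ ℕ→ℚ n
size-⊤ n = cong ℕ→ℚ (∣⊤∣≡n n)

size-mono : ∀ {n} (p q : Subset n) → p ⊆ q → size p ≤ size q
size-mono p q p⊆q = ℕ→ℚ-mono {∣ p ∣} {∣ q ∣} (p⊆q⇒∣p∣≤∣q∣ p⊆q)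

∣p∣≤∣p∩∁q∣+∣q∣ : ∀ {n} (p q : Subset n) → ∣ p ∣ ℕ.≤ ∣ p ∩ ∁ q ∣ ℕ.+ ∣ q ∣
∣p∣≤∣p∩∁q∣+∣q∣ []          []          = ℕ.z≤n
∣p∣≤∣p∩∁q∣+∣q∣ (false ∷ p) (false ∷ q) = ∣p∣≤∣p∩∁q∣+∣q∣ p q
∣p∣≤∣p∩∁q∣+∣q∣ (true  ∷ p) (false ∷ q) = ℕ.s≤s (∣p∣≤∣p∩∁q∣+∣q∣ p q)
∣p∣≤∣p∩∁q∣+∣q∣ (false ∷ p) (true  ∷ q) =
  ℕ.≤-trans (ℕ.m≤n⇒m≤1+n (∣p∣≤∣p∩∁q∣+∣q∣ p q)) (ℕ.≤-reflexive (≡-sym (ℕ.+-suc _ _)))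
∣p∣≤∣p∩∁q∣+∣q∣ (true  ∷ p) (true  ∷ q) =
  ℕ.≤-trans (ℕ.s≤s (∣p∣≤∣p∩∁q∣+∣q∣ p q)) (ℕ.≤-reflexive (≡-sym (ℕ.+-suc _ _)))

size-split : ∀ {n} (p q : Subset n) → size p ≤ size (p ∩ ∁ q) + size q
size-split p q = subst (size p ≤_) (ℕ→ℚ-+ ∣ p ∩ ∁ q ∣ ∣ q ∣) (ℕ→ℚ-mono (∣p∣≤∣p∩∁q∣+∣q∣ p q))

∈-tabulate⁻ : ∀ {n} {f : Fin n → Bool} {v} → v ∈ tabulate f → f v ≡ true
∈-tabulate⁻ {f = f} {v} v∈ = trans (≡-sym (lookup∘tabulate f v)) ([]=⇒lookup v∈)

∈-tabulate⁺ : ∀ {n} {f : Fin n → Bool} {v} → f v ≡ true → v ∈ tabulate f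
∈-tabulate⁺ {f = f} {v} fv = lookup⇒[]= v _ (trans (lookup∘tabulate f v) fv)

∧-true⁻ : ∀ {a b} → a ∧ b ≡ true → a ≡ true × b ≡ true
∧-true⁻ {true} {true} refl = refl , refl

module _ {n} (G : Graph n) (W : Subset n) (ν : ℚ) (X : Subset n) {v : Fin n} where

  ∈RN⁻ : v ∈ RN G W ν X → v ∈ W × ν * size W ≤ size ((N G v ∩ W) ∩ X)
  ∈RN⁻ v∈RN with ∧-true⁻ (∈-tabulate⁻ v∈RN)
  ... | v∈W , deg = lookup⇒[]= v W v∈W , toWitness (Equivalence.from T-≡ deg)

  ∈RN⁺ : v ∈ W → ν * size W ≤ size ((N G v ∩ W) ∩ X) → v ∈ RN G W ν X
  ∈RN⁺ v∈W deg =
    ∈-tabulate⁺ (cong₂ _∧_ ([]=⇒lookup v∈W) (Equivalence.to T-≡ (fromWitness deg)))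

-- Passing from G[U] to G[U ∩ T]: if X ⊆ U ∩ T then every neighbour of v in
-- U ∩ X lies in U ∩ T, so a vertex of T that is robust for X in G[U] stays
-- robust in G[U ∩ T] for any threshold ν' with ν'|U ∩ T| ≤ ν|U|.
RN-restrict : ∀ {n} (G : Graph n) (U T X : Subset n) (ν ν' : ℚ) →
  X ⊆ U ∩ T → ν' * size (U ∩ T) ≤ ν * size U →
  RN G U ν X ∩ T ⊆ RN G (U ∩ T) ν' X
RN-restrict G U T X ν ν' X⊆W threshold {v} v∈ =
  ∈RN⁺ G W ν' X (x∈p∩q⁺ (v∈U , v∈T))
    (≤-trans threshold (≤-trans deg (size-mono _ _ neighbours-stay)))
  where
  W = U ∩ T
  v∈T = proj₂ (x∈p∩q⁻ _ T v∈)
  robust = ∈RN⁻ G U ν X (proj₁ (x∈p∩q⁻ _ T v∈))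
  v∈U = proj₁ robust
  deg = proj₂ robust

  neighbours-stay : (N G v ∩ U) ∩ X ⊆ (N G v ∩ W) ∩ X
  neighbours-stay {u} u∈ with x∈p∩q⁻ _ X u∈
  ... | u∈NU , u∈X =
    x∈p∩q⁺ (x∈p∩q⁺ (proj₁ (x∈p∩q⁻ _ U u∈NU) , X⊆W u∈X) , u∈X)

module _ where
  open ℚ-≤-Reasoning

  scale : ∀ {c a b} → 0ℚ ≤ c → a ≤ b → c * a ≤ c * b
  scale {c} 0≤c = *-monoˡ-≤-nonNeg c {{nonNegative 0≤c}}

  ≤-+-nonneg : ∀ {p d} → 0ℚ ≤ d → p ≤ p + d
  ≤-+-nonneg {p} {d} 0≤d = begin
    p       ≡⟨ solve 1 (λ p → p := p :+ con 0ℚ) refl p ⟩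
    p + 0ℚ  ≤⟨ +-monoʳ-≤ p 0≤d ⟩
    p + d   ∎

  nonneg-* : ∀ {a b} → 0ℚ ≤ a → 0ℚ ≤ b → 0ℚ ≤ a * b
  nonneg-* {a} {b} 0≤a 0≤b = begin
    0ℚ     ≡⟨ solve 1 (λ a → con 0ℚ := a :* con 0ℚ) refl a ⟩
    a * 0ℚ ≤⟨ scale 0≤a 0≤b ⟩
    a * b  ∎

  nonneg-− : ∀ {p q} → p ≤ q → 0ℚ ≤ q - p
  nonneg-− {p} {q} p≤q = begin
    0ℚ     ≡⟨ solve 1 (λ p → con 0ℚ := p :- p) refl p ⟩
    p - p  ≤⟨ +-monoˡ-≤ (- p) p≤q ⟩
    q - p  ∎

  move-− : ∀ {p q r} → p ≤ q + r → p - r ≤ q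
  move-− {p} {q} {r} p≤q+r = begin
    p - r        ≤⟨ +-monoˡ-≤ (- r) p≤q+r ⟩
    (q + r) - r  ≡⟨ solve 2 (λ q r → (q :+ r) :- r := q) refl q r ⟩
    q            ∎

  -- In the setting M ≤ N ≤ M + αN (M = |U ∖ S|, N = |U|), the interval
  -- condition for G[U ∖ S] with τ + α implies the one for G[U] with τ.
  interval-transfer : ∀ {α τ M N x} → 0ℚ ≤ α → 0ℚ ≤ τ → τ + α ≤ 1ℚ → 0ℚ ≤ N →
    M ≤ N → N ≤ M + α * N →
    (τ + α) * M ≤ x → x ≤ (1ℚ - (τ + α)) * M →
    τ * N ≤ x × x ≤ (1ℚ - τ) * N
  interval-transfer {α} {τ} {M} {N} {x} 0≤α 0≤τ τ+α≤1 0≤N M≤N N≤M+αN lower upper =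
    (begin
      τ * N                                   ≤⟨ ≤-+-nonneg (nonneg-* αN≥0 slack≥0) ⟩
      τ * N + α * N * (1ℚ - (τ + α))          ≡⟨ solve 3 (λ τ α N →
          τ :* N :+ α :* N :* (con 1ℚ :- (τ :+ α)) := (τ :+ α) :* (N :- α :* N)) refl τ α N ⟩
      (τ + α) * (N - α * N)                   ≤⟨ scale (+-mono-≤ 0≤τ 0≤α) (move-− N≤M+αN) ⟩
      (τ + α) * M                             ≤⟨ lower ⟩
      x                                       ∎)
    , (begin
      x                                       ≤⟨ upper ⟩
      (1ℚ - (τ + α)) * M                      ≤⟨ scale slack≥0 M≤N ⟩
      (1ℚ - (τ + α)) * N                      ≤⟨ ≤-+-nonneg αN≥0 ⟩
      (1ℚ - (τ + α)) * N + α * N              ≡⟨ solve 3 (λ τ α N →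
          (con 1ℚ :- (τ :+ α)) :* N :+ α :* N := (con 1ℚ :- τ) :* N) refl τ α N ⟩
      (1ℚ - τ) * N                            ∎)
    where
    αN≥0 = nonneg-* 0≤α 0≤N
    slack≥0 = nonneg-− τ+α≤1

  threshold-transfer : ∀ {α ν M N} → 0ℚ ≤ α → α ≤ ν → 0ℚ ≤ N → M ≤ N →
    (ν - α) * M ≤ ν * N
  threshold-transfer {α} {ν} {M} {N} 0≤α α≤ν 0≤N M≤N = begin
    (ν - α) * M          ≤⟨ scale (nonneg-− α≤ν) M≤N ⟩
    (ν - α) * N          ≤⟨ ≤-+-nonneg (nonneg-* 0≤α 0≤N) ⟩
    (ν - α) * N + α * N  ≡⟨ solve 3 (λ ν α N → (ν :- α) :* N :+ α :* N := ν :* N) refl ν α N ⟩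
    ν * N                ∎

  -- Expansion by ν|U| in G[U], minus at most α|U| lost vertices, is still
  -- expansion by (ν - α)|W| in G[W].
  expansion-transfer : ∀ {α ν M N x a b} → α ≤ ν → M ≤ N →
    x + ν * N ≤ a → a ≤ b + α * N → x + (ν - α) * M ≤ b
  expansion-transfer {α} {ν} {M} {N} {x} {a} {b} α≤ν M≤N expands loses = begin
    x + (ν - α) * M        ≤⟨ +-monoʳ-≤ x (scale (nonneg-− α≤ν) M≤N) ⟩
    x + (ν - α) * N        ≡⟨ solve 4 (λ x ν α N → x :+ (ν :- α) :* N := (x :+ ν :* N) :- α :* N)
                                refl x ν α N ⟩
    (x + ν * N) - α * N    ≤⟨ move-− (≤-trans expands loses) ⟩
    b                      ∎

robust-expander-minus : ∀ {n} (G : Graph n) (U S : Subset n) {α ν τ : ℚ} →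
  0ℚ ≤ α → 0ℚ ≤ τ → α ≤ ν → τ + α ≤ 1ℚ → size S ≡ α * size U →
  RobustExpanderOn G U ν τ → RobustExpanderOn G (U ∩ ∁ S) (ν - α) (τ + α)
robust-expander-minus G U S {α} {ν} {τ} 0≤α 0≤τ α≤ν τ+α≤1 |S|≡αN expander X X⊆W lower upper =
  ≤-trans (expansion-transfer {x = size X} {a = size A} α≤ν M≤N expansion-in-U losses)
          survivors-robust
  where
  W = U ∩ ∁ S
  A = RN G U ν X

  M≤N : size W ≤ size U
  M≤N = size-mono W U (p∩q⊆p U (∁ S))

  N≤M+αN : size U ≤ size W + α * size U
  N≤M+αN = subst (λ s → size U ≤ size W + s) |S|≡αN (size-split U S)

  X-in-interval : τ * size U ≤ size X × size X ≤ (1ℚ - τ) * size U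
  X-in-interval = interval-transfer 0≤α 0≤τ τ+α≤1 (size-nonneg U) M≤N N≤M+αN lower upper

  expansion-in-U : size X + ν * size U ≤ size A
  expansion-in-U = expander X (λ x∈X → p∩q⊆p U (∁ S) (X⊆W x∈X))
                     (proj₁ X-in-interval) (proj₂ X-in-interval)

  losses : size A ≤ size (A ∩ ∁ S) + α * size U
  losses = subst (λ s → size A ≤ size (A ∩ ∁ S) + s) |S|≡αN (size-split A S)

  survivors-robust : size (A ∩ ∁ S) ≤ size (RN G W (ν - α) X)
  survivors-robust = size-mono (A ∩ ∁ S) (RN G W (ν - α) X)
    (RN-restrict G U (∁ S) X ν (ν - α) X⊆W (threshold-transfer 0≤α α≤ν (size-nonneg U) M≤N))

-- Lemma 5.4: with τ₀ = ½ we get 0 < α < ν ≤ τ ≤ ½, hence 0 ≤ τ and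
-- τ + α ≤ 1; apply the general form to U = V(G), where V(G) ∖ S = ∁ S.
lemma5p4 : Σ ℚ λ τ₀ → 0ℚ < τ₀ ×
    (∀ (α ν τ : ℚ) → 0ℚ < α → α < ν → ν ≤ τ → τ ≤ τ₀ →
    ∀ (n : ℕ) (G : Graph n) → RobustExpander G ν τ →
    ∀ (S : Subset n) → size S ≡ α * ℕ→ℚ n →
    RobustExpanderMinus G S (ν - α) (τ + α))
lemma5p4 = ½ , positive⁻¹ ½ , minus
  where
  minus : ∀ (α ν τ : ℚ) → 0ℚ < α → α < ν → ν ≤ τ → τ ≤ ½ →
    ∀ (n : ℕ) (G : Graph n) → RobustExpander G ν τ →
    ∀ (S : Subset n) → size S ≡ α * ℕ→ℚ n →
    RobustExpanderMinus G S (ν - α) (τ + α)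
  minus α ν τ 0<α α<ν ν≤τ τ≤½ n G expander S |S|≡αn =
    subst (λ W → RobustExpanderOn G W (ν - α) (τ + α)) (∩-identityˡ (∁ S))
      (robust-expander-minus G ⊤ S (<⇒≤ 0<α) 0≤τ α≤ν τ+α≤1
        (trans |S|≡αn (cong (α *_) (≡-sym (size-⊤ n)))) expander)
    where
    α≤ν = <⇒≤ α<ν
    0≤τ = ≤-trans (<⇒≤ 0<α) (≤-trans α≤ν ν≤τ)
    τ+α≤1 : τ + α ≤ 1ℚ
    τ+α≤1 = +-mono-≤ τ≤½ (≤-trans α≤ν (≤-trans ν≤τ τ≤½))
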